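{- Let $(V,E,F,H)$ be an instance of Constrained Correlation Clustering admitting a valid clustering, and let $G'=\textsc{Transform}(G,F,H)$. For every $uv\in F$, the nodes $u$ and $v$ are adjacent in $G'$ and have the same neighborhood in $G'$ (apart from each other).
   Context: Instance: graph $G=(V,E)$, friendly pairs $F$, hostile pairs $H\subseteq\binom V2$; a clustering (partition of $V$) is valid if no pair of $F$ is split and no pair of $H$ lies in one cluster. Supernodes are connected components of $(V,F)$; $s(u)$ is the supernode of $u$; supernodes $U,W$ are hostile if some $uw\in H$ has $u\in U,w\in W$. $\textsc{Transform}(G,F,H)$: if some supernode is hostile to itself return $(\emptyset,\emptyset)$; otherwise $E_1=E\cup\{uv:s(u)=s(v)\}$, $E_2=E_1\setminus\{uv:s(u),s(v)\text{ hostile}\}$, $E_3$ obtained from $E_2$ by repeatedly, while there exist distinct supernodes $U_1,U_2,U_3$ with $U_1,U_2$ hostile and $u_1\in U_1,u_2\in U_2,u_3,u_3'\in U_3$ with $u_1u_3,u_2u_3'\in E_3$, removing these two edges, and $E_4$ obtained from $E_3$ by, for each pair of distinct supernodes $U_1,U_2$, adding all pairs between them if more than $\frac{3-\sqrt5}2|U_1||U_2|$ of them are edges and removing all of them otherwise; return $(V,E_4)$. -}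

module Defs where

open import Data.Bool using (Bool; true; false; _∧_; _∨_; not; if_then_else_)
open import Data.Nat using (ℕ; zero; suc; _+_; _*_; _∸_; _^_; _<ᵇ_)
open import Data.Fin using (Fin; _≟_)
open import Data.List using (List; map; allFin)
open import Data.Bool.ListAction using (any)
open import Data.Nat.ListAction using (sum)
open import Data.Product using (Σ; _×_; ∃)
open import Relation.Nullary using (¬_)
open import Relation.Nullary.Decidable using (⌊_⌋)
open import Relation.Binary.PropositionalEquality using (_≡_; _≢_)
open import Relation.Binary.Construct.Closure.ReflexiveTransitive using (Star)

-- A binary relation on the vertex set V = Fin n, given by its
-- characteristic function.  Sets of (unordered) pairs of vertices
-- (E, F, H, and the edge sets E₁ … E₄) are encoded this way.
BRel : ℕ → Set
BRel n = Fin n → Fin n → Bool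

module _ {n : ℕ} where

  eqV : Fin n → Fin n → Bool
  eqV x y = ⌊ x ≟ y ⌋

  anyV : (Fin n → Bool) → Bool
  anyV p = any p (allFin n)

  sumV : (Fin n → ℕ) → ℕ
  sumV f = sum (map f (allFin n))

  countV : (Fin n → Bool) → ℕ
  countV p = sumV (λ a → if p a then 1 else 0)

  pairIn : BRel n → Fin n → Fin n → Bool
  pairIn R u v = R u v ∨ R v u

  IsGraph : BRel n → Set
  IsGraph E = (∀ u v → E u v ≡ E v u) × (∀ u → E u u ≡ false)

  Irrefl : BRel n → Set
  Irrefl R = ∀ u → R u u ≡ false

  reach : BRel n → ℕ → Fin n → Fin n → Bool
  reach F zero    x y = eqV x y
  reach F (suc k) x y = reach F k x y ∨ anyV (λ z → reach F k x z ∧ pairIn F z y)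

  -- s(x) = s(y): x and y lie in the same connected component of (V, F),
  -- i.e. in the same supernode (a path of length ≤ n always suffices).
  sameS : BRel n → Fin n → Fin n → Bool
  sameS F x y = reach F n x y

  hostileS : BRel n → BRel n → Fin n → Fin n → Bool
  hostileS F H x y =
    anyV (λ a → anyV (λ b → sameS F x a ∧ sameS F y b ∧ pairIn H a b))

  selfHostile : BRel n → BRel n → Bool
  selfHostile F H = anyV (λ x → hostileS F H x x)

  -- A valid clustering, given as a labelling of vertices by cluster names.
  ValidClustering : BRel n → BRel n → (Fin n → ℕ) → Set
  ValidClustering F H c =
    (∀ u v → pairIn F u v ≡ true → c u ≡ c v) ×
    (∀ u v → pairIn H u v ≡ true → c u ≢ c v)

  E₁ : BRel n → BRel n → BRel n
  E₁ F E u v = E u v ∨ (not (eqV u v) ∧ sameS F u v)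

  E₂ : BRel n → BRel n → BRel n → BRel n
  E₂ F H E u v = E₁ F E u v ∧ not (hostileS F H u v)

  removePair : Fin n → Fin n → BRel n → BRel n
  removePair a b R x y = R x y ∧ not ((eqV x a ∧ eqV y b) ∨ (eqV x b ∧ eqV y a))

  Applicable : BRel n → BRel n → BRel n → Fin n → Fin n → Fin n → Fin n → Set
  Applicable F H R u₁ u₂ u₃ u₃' =
    (sameS F u₁ u₂ ≡ false) × (sameS F u₁ u₃ ≡ false) × (sameS F u₂ u₃ ≡ false) ×
    (sameS F u₃ u₃' ≡ true) × (hostileS F H u₁ u₂ ≡ true) ×
    (R u₁ u₃ ≡ true) × (R u₂ u₃' ≡ true)

  data Step3 (F H : BRel n) : BRel n → BRel n → Set where
    step : ∀ {R} u₁ u₂ u₃ u₃' → Applicable F H R u₁ u₂ u₃ u₃' →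
           Step3 F H R (removePair u₂ u₃' (removePair u₁ u₃ R))

  IsE₃ : BRel n → BRel n → BRel n → BRel n → Set
  IsE₃ F H E R =
    Star (Step3 F H) (E₂ F H E) R ×
    (∀ u₁ u₂ u₃ u₃' → ¬ Applicable F H R u₁ u₂ u₃ u₃')

  sizeS : BRel n → Fin n → ℕ
  sizeS F u = countV (λ a → sameS F u a)

  edgesBetween : BRel n → BRel n → Fin n → Fin n → ℕ
  edgesBetween F R u v =
    sumV (λ a → if sameS F u a then countV (λ b → sameS F v b ∧ R a b) else 0)

  -- c > ((3 - √5)/2) · m,  written out over ℕ:
  -- equivalently 3m - 2c < √5 m, i.e. 3m < 2c or (3m - 2c)² < 5m².
  aboveThreshold : ℕ → ℕ → Bool
  aboveThreshold c m = (3 * m <ᵇ 2 * c) ∨ (((3 * m ∸ 2 * c) ^ 2) <ᵇ (5 * m ^ 2))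

  E₄ : BRel n → BRel n → BRel n
  E₄ F R u v =
    if sameS F u v then R u v
    else aboveThreshold (edgesBetween F R u v) (sizeS F u * sizeS F v)

  -- G' = (V, E') is an output of Transform(G,F,H) in the case where
  -- Transform does not return (∅,∅).
  IsTransform : BRel n → BRel n → BRel n → BRel n → Set
  IsTransform E F H E' =
    (selfHostile F H ≡ false) ×
    Σ (BRel n) (λ R → IsE₃ F H E R × (∀ u v → E' u v ≡ E₄ F R u v))

-- Transform treats every supernode as a unit.  Pairs inside a supernode are
-- edges of E₁ and survive E₂ because a valid clustering keeps each supernode
-- in one cluster, so no supernode is hostile to itself; the removal steps only
-- delete pairs joining distinct supernodes; and E₄ decides the pairs between
-- two distinct supernodes from data depending only on the supernodes.  Hence
-- two nodes of one supernode, in particular the ends of a friendly pair, are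
-- adjacent twins in G'.  The one technical point is that sameS, reachability
-- along at most n friendly pairs, is an equivalence relation: the sets reached
-- in k steps form an ascending chain of subsets of V which, once it stalls,
-- stays put, and which cannot grow strictly n + 1 times.
module Submission where

open import Defs
open import Data.Bool using (Bool; true; false; _∧_; _∨_; if_then_else_)
open import Data.Bool.Properties using (∨-zeroʳ; ∨-comm; ¬-not; T-≡)
open import Data.Fin using (Fin; _≟_)
open import Data.Fin.Subset using (Subset; _∈_; _⊆_; _⊂_; ∣_∣)
open import Data.Fin.Subset.Properties using (_∈?_; _⊂?_; p⊂q⇒∣p∣<∣q∣; ∣p∣≤n)
open import Data.List using (allFin)
open import Data.List.Properties using (map-cong)
open import Data.List.Membership.Propositional using (lose)
open import Data.List.Membership.Propositional.Properties using (∈-allFin)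
open import Data.List.Relation.Unary.Any using (satisfied)
open import Data.List.Relation.Unary.Any.Properties using (any⁺; any⁻)
open import Data.Nat using (ℕ; zero; suc; _*_; _<_; z≤n)
open import Data.Nat.ListAction using (sum)
open import Data.Nat.Properties using (≤-<-trans; <-≤-trans; <-irrefl)
open import Data.Product using (∃; _×_; _,_)
open import Data.Sum using (_⊎_; inj₁; inj₂)
open import Data.Vec using (tabulate)
open import Data.Vec.Properties using (lookup∘tabulate; []=⇒lookup; lookup⇒[]=)
open import Function using (case_of_)
open import Function.Bundles using (Equivalence)
open import Relation.Binary.Construct.Closure.ReflexiveTransitive using (Star; ε; _◅_)
open import Relation.Binary.PropositionalEquality
  using (_≡_; _≢_; refl; sym; trans; cong; cong₂; ≢-sym; module ≡-Reasoning)
open import Relation.Nullary using (¬_; yes; no; contradiction)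

open Equivalence using (to; from)

∨-true⁻ : ∀ a {b} → a ∨ b ≡ true → a ≡ true ⊎ b ≡ true
∨-true⁻ true  _ = inj₁ refl
∨-true⁻ false e = inj₂ e

∨-trueʳ : ∀ a {b} → b ≡ true → a ∨ b ≡ true
∨-trueʳ a refl = ∨-zeroʳ a

∧-true⁻ : ∀ a {b} → a ∧ b ≡ true → a ≡ true × b ≡ true
∧-true⁻ true e = refl , e

module _ {n : ℕ} where

  anyV-true⁻ : ∀ (p : Fin n → Bool) → anyV p ≡ true → ∃ λ x → p x ≡ true
  anyV-true⁻ p e with x , px ← satisfied (any⁻ p (allFin n) (from T-≡ e)) = x , to T-≡ px

  anyV-true⁺ : ∀ (p : Fin n → Bool) x → p x ≡ true → anyV p ≡ true
  anyV-true⁺ p x px = to T-≡ (any⁺ p (lose (∈-allFin x) (from T-≡ px)))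

  sumV-cong : ∀ {f g : Fin n → ℕ} → (∀ a → f a ≡ g a) → sumV f ≡ sumV g
  sumV-cong f≗g = cong sum (map-cong f≗g (allFin n))

  countV-cong : ∀ {p q : Fin n → Bool} → (∀ a → p a ≡ q a) → countV p ≡ countV q
  countV-cong p≗q = sumV-cong (λ a → cong (λ b → if b then 1 else 0) (p≗q a))

  eqV-refl : ∀ (x : Fin n) → eqV x x ≡ true
  eqV-refl x with x ≟ x
  ... | yes _  = refl
  ... | no x≢x = contradiction refl x≢x

  eqV-true⁻ : ∀ {x y : Fin n} → eqV x y ≡ true → x ≡ y
  eqV-true⁻ {x} {y} e with x ≟ y
  ... | yes x≡y = x≡y

  eqV-false : ∀ {x y : Fin n} → x ≢ y → eqV x y ≡ false
  eqV-false {x} {y} x≢y with x ≟ y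
  ... | yes x≡y = contradiction x≡y x≢y
  ... | no _    = refl

  eqV-pair-false : ∀ {x a y b : Fin n} → ¬ (x ≡ a × y ≡ b) → (eqV x a ∧ eqV y b) ≡ false
  eqV-pair-false {x = x} {a} {y} {b} ¬xy≡ab with x ≟ a | y ≟ b
  ... | yes x≡a | yes y≡b = contradiction (x≡a , y≡b) ¬xy≡ab
  ... | yes _   | no _    = refl
  ... | no _    | _       = refl

  ∈-tabulate⁻ : ∀ (f : Fin n → Bool) {y} → y ∈ tabulate f → f y ≡ true
  ∈-tabulate⁻ f {y} y∈ = trans (sym (lookup∘tabulate f y)) ([]=⇒lookup y∈)

  ∈-tabulate⁺ : ∀ (f : Fin n → Bool) {y} → f y ≡ true → y ∈ tabulate f
  ∈-tabulate⁺ f {y} fy = lookup⇒[]= y (tabulate f) (trans (lookup∘tabulate f y) fy)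

module AscendingChain {n : ℕ} (P : ℕ → Subset n) (ascending : ∀ k → P k ⊆ P (suc k)) where

  stalls-or-grows : ∀ k → P (suc k) ⊆ P k ⊎ P k ⊂ P (suc k)
  stalls-or-grows k with P k ⊂? P (suc k)
  ... | yes grows = inj₂ grows
  ... | no ¬grows = inj₁ λ {y} y∈Pk+1 → case y ∈? P k of λ where
    (yes y∈Pk) → y∈Pk
    (no y∉Pk)  → contradiction ((λ {x} → ascending k {x}) , y , y∈Pk+1 , y∉Pk) ¬grows

  module _ (stall-persists : ∀ k → P (suc k) ⊆ P k → P (suc (suc k)) ⊆ P (suc k)) where

    stalls-or-large : ∀ k → P (suc k) ⊆ P k ⊎ k < ∣ P (suc k) ∣
    stalls-or-large zero with stalls-or-grows zero
    ... | inj₁ stalls = inj₁ stalls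
    ... | inj₂ grows  = inj₂ (≤-<-trans z≤n (p⊂q⇒∣p∣<∣q∣ grows))
    stalls-or-large (suc k) with stalls-or-large k
    ... | inj₁ stalls = inj₁ (stall-persists k stalls)
    ... | inj₂ large with stalls-or-grows (suc k)
    ...   | inj₁ stalls = inj₁ stalls
    ...   | inj₂ grows  = inj₂ (≤-<-trans large (p⊂q⇒∣p∣<∣q∣ grows))

    stalls-by-n : P (suc n) ⊆ P n
    stalls-by-n with stalls-or-large n
    ... | inj₁ stalls = stalls
    ... | inj₂ large  = contradiction (<-≤-trans large (∣p∣≤n (P (suc n)))) (<-irrefl refl)

module Supernodes {n : ℕ} (F : BRel n) where

  reach-mono : ∀ k {x y} → reach F k x y ≡ true → reach F (suc k) x y ≡ true
  reach-mono k xy rewrite xy = refl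

  reach-refl : ∀ k x → reach F k x x ≡ true
  reach-refl zero    x = eqV-refl x
  reach-refl (suc k) x = reach-mono k (reach-refl k x)

  reach-step : ∀ k {x y z} → reach F k x y ≡ true → pairIn F y z ≡ true → reach F (suc k) x z ≡ true
  reach-step k {x} {y} {z} xy yz =
    ∨-trueʳ (reach F k x z) (anyV-true⁺ (λ w → reach F k x w ∧ pairIn F w z) y (cong₂ _∧_ xy yz))

  reach-step⁻ : ∀ k {x z} → reach F (suc k) x z ≡ true →
                reach F k x z ≡ true ⊎ ∃ λ y → reach F k x y ≡ true × pairIn F y z ≡ true
  reach-step⁻ k {x} {z} e with ∨-true⁻ (reach F k x z) e
  ... | inj₁ xz = inj₁ xz
  ... | inj₂ ∃y with y , xy∧yz ← anyV-true⁻ _ ∃y = inj₂ (y , ∧-true⁻ (reach F k x y) xy∧yz)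

  reach-ind : (R : Fin n → Fin n → Set) → (∀ x → R x x) →
              (∀ {x y z} → R x y → pairIn F y z ≡ true → R x z) →
              ∀ k {x y} → reach F k x y ≡ true → R x y
  reach-ind R refl-R step-R zero    {x} e with refl ← eqV-true⁻ e = refl-R x
  reach-ind R refl-R step-R (suc k) {x} {z} e with reach-step⁻ k e
  ... | inj₁ xz            = reach-ind R refl-R step-R k xz
  ... | inj₂ (y , xy , yz) = step-R (reach-ind R refl-R step-R k xy) yz

  reachable : ℕ → Fin n → Subset n
  reachable k x = tabulate (reach F k x)

  reachable-ascending : ∀ x k → reachable k x ⊆ reachable (suc k) x
  reachable-ascending x k y∈ = ∈-tabulate⁺ (reach F (suc k) x) (reach-mono k (∈-tabulate⁻ (reach F k x) y∈))

  reachable-stall-persists : ∀ x k → reachable (suc k) x ⊆ reachable k x →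
                             reachable (suc (suc k)) x ⊆ reachable (suc k) x
  reachable-stall-persists x k stalls y∈ with reach-step⁻ (suc k) (∈-tabulate⁻ (reach F (suc (suc k)) x) y∈)
  ... | inj₁ xy            = ∈-tabulate⁺ (reach F (suc k) x) xy
  ... | inj₂ (z , xz , zy) = ∈-tabulate⁺ (reach F (suc k) x) (reach-step k xz′ zy)
    where xz′ = ∈-tabulate⁻ (reach F k x) (stalls (∈-tabulate⁺ (reach F (suc k) x) xz))

  reach-suc-n⇒sameS : ∀ {x y} → reach F (suc n) x y ≡ true → sameS F x y ≡ true
  reach-suc-n⇒sameS {x} e = ∈-tabulate⁻ (reach F n x) (stalls-by-n (reachable-stall-persists x) (∈-tabulate⁺ (reach F (suc n) x) e))
    where open AscendingChain (λ k → reachable k x) (reachable-ascending x)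

  sameS-refl : ∀ x → sameS F x x ≡ true
  sameS-refl = reach-refl n

  sameS-step : ∀ {x y z} → sameS F x y ≡ true → pairIn F y z ≡ true → sameS F x z ≡ true
  sameS-step xy yz = reach-suc-n⇒sameS (reach-step n xy yz)

  pairIn⇒sameS : ∀ {x y} → pairIn F x y ≡ true → sameS F x y ≡ true
  pairIn⇒sameS = sameS-step (sameS-refl _)

  sameS-trans : ∀ {x y z} → sameS F x y ≡ true → sameS F y z ≡ true → sameS F x z ≡ true
  sameS-trans {x} xy yz =
    reach-ind (λ y z → sameS F x y ≡ true → sameS F x z ≡ true) (λ _ h → h)
              (λ xy⇒xz yz h → sameS-step (xy⇒xz h) yz) n yz xy

  sameS-sym : ∀ {x y} → sameS F x y ≡ true → sameS F y x ≡ true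
  sameS-sym = reach-ind (λ x y → sameS F y x ≡ true) sameS-refl
    (λ {x} {y} {z} yx yz → sameS-trans (pairIn⇒sameS (trans (∨-comm (F z y) (F y z)) yz)) yx) n

  sameS-cong : ∀ {u v} → sameS F u v ≡ true → ∀ a → sameS F u a ≡ sameS F v a
  sameS-cong {u} {v} uv a with sameS F u a in ua | sameS F v a in va
  ... | true  | true  = refl
  ... | false | false = refl
  ... | true  | false = trans (sym (sameS-trans (sameS-sym uv) ua)) va
  ... | false | true  = sym (trans (sym (sameS-trans uv va)) ua)

  sameS-invariant : ∀ {A : Set} (c : Fin n → A) → (∀ u v → pairIn F u v ≡ true → c u ≡ c v) →
                    ∀ {x y} → sameS F x y ≡ true → c x ≡ c y
  sameS-invariant c c-F = reach-ind (λ x y → c x ≡ c y) (λ _ → refl) (λ xy yz → trans xy (c-F _ _ yz)) n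

module Transformation {n : ℕ} (F H : BRel n) where
  open Supernodes F

  valid⇒sameS-not-hostile : ∀ {c : Fin n → ℕ} → ValidClustering F H c →
                            ∀ {x y} → sameS F x y ≡ true → hostileS F H x y ≡ false
  valid⇒sameS-not-hostile {c} (c-F , c-H) {x} {y} xy = ¬-not λ hostile →
    let a , ∃b  = anyV-true⁻ _ hostile
        b , xab = anyV-true⁻ _ ∃b
        xa , yb∧ab = ∧-true⁻ (sameS F x a) xab
        yb , ab    = ∧-true⁻ (sameS F y b) yb∧ab
        c-sameS    = sameS-invariant c c-F
    in c-H a b ab (trans (sym (c-sameS xa)) (trans (c-sameS xy) (c-sameS yb)))

  CompleteOnSupernodes : BRel n → Set
  CompleteOnSupernodes R = ∀ {x y} → sameS F x y ≡ true → x ≢ y → R x y ≡ true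

  E₂-complete : ∀ E {c : Fin n → ℕ} → ValidClustering F H c → CompleteOnSupernodes (E₂ F H E)
  E₂-complete E valid {x} {y} xy x≢y
    rewrite eqV-false x≢y | xy | ∨-zeroʳ (E x y) | valid⇒sameS-not-hostile valid xy = refl

  removePair-complete : ∀ {a b R} → sameS F a b ≡ false →
                        CompleteOnSupernodes R → CompleteOnSupernodes (removePair a b R)
  removePair-complete {a} {b} ab complete {x} {y} xy x≢y
    rewrite complete xy x≢y
          | eqV-pair-false {x = x} {a} {y} {b} (λ { (refl , refl) → contradiction (trans (sym xy) ab) λ () })
          | eqV-pair-false {x = x} {b} {y} {a} (λ { (refl , refl) → contradiction (trans (sym (sameS-sym xy)) ab) λ () })
    = refl

  Step3-complete : ∀ {R R′} → Step3 F H R R′ → CompleteOnSupernodes R → CompleteOnSupernodes R′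
  Step3-complete (step u₁ u₂ u₃ u₃′ (_ , u₁u₃ , u₂u₃ , u₃u₃′ , _)) complete =
    removePair-complete u₂u₃′ (removePair-complete u₁u₃ complete)
    where
    u₂u₃′ : sameS F u₂ u₃′ ≡ false
    u₂u₃′ = ¬-not λ u₂∼u₃′ → contradiction (trans (sym (sameS-trans u₂∼u₃′ (sameS-sym u₃u₃′))) u₂u₃) λ ()

  Star-complete : ∀ {R R′} → Star (Step3 F H) R R′ → CompleteOnSupernodes R → CompleteOnSupernodes R′
  Star-complete ε          complete = complete
  Star-complete (s ◅ steps) complete = Star-complete steps (Step3-complete s complete)

  E₄-within : ∀ R {u w} → sameS F u w ≡ true → E₄ F R u w ≡ R u w
  E₄-within R uw rewrite uw = refl

  -- aboveThreshold is declared under an anonymous module over n, so its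
  -- implicit n is not determined by its type and has to be supplied.
  E₄-between : ∀ R {u w} → sameS F u w ≡ false →
               E₄ F R u w ≡ aboveThreshold {n = n} (edgesBetween F R u w) (sizeS F u * sizeS F w)
  E₄-between R uw rewrite uw = refl

  E₄-cong : ∀ R {u v w} → (∀ a → sameS F u a ≡ sameS F v a) →
            (sameS F u w ≡ true → R u w ≡ R v w) → E₄ F R u w ≡ E₄ F R v w
  E₄-cong R {u} {v} {w} u≗v R-within = by-cases (sameS F u w) refl
    where
    open ≡-Reasoning
    by-cases : ∀ b → sameS F u w ≡ b → E₄ F R u w ≡ E₄ F R v w
    by-cases true uw = begin
      E₄ F R u w ≡⟨ E₄-within R uw ⟩
      R u w      ≡⟨ R-within uw ⟩
      R v w      ≡⟨ E₄-within R (trans (sym (u≗v w)) uw) ⟨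
      E₄ F R v w ∎
    by-cases false uw = begin
      E₄ F R u w                      ≡⟨ E₄-between R uw ⟩
      threshold (edgesBetween F R u w)
                (sizeS F u * sizeS F w) ≡⟨ cong₂ threshold edges sizes ⟩
      threshold (edgesBetween F R v w)
                (sizeS F v * sizeS F w) ≡⟨ E₄-between R (trans (sym (u≗v w)) uw) ⟨
      E₄ F R v w                      ∎
      where
      threshold = aboveThreshold {n = n}
      edges : edgesBetween F R u w ≡ edgesBetween F R v w
      edges = sumV-cong λ a → cong (λ b → if b then countV (λ b′ → sameS F w b′ ∧ R a b′) else 0) (u≗v a)
      sizes : sizeS F u * sizeS F w ≡ sizeS F v * sizeS F w
      sizes = cong (_* sizeS F w) (countV-cong u≗v)

  E₄-twins : ∀ {R} → CompleteOnSupernodes R → ∀ {u v w} → sameS F u v ≡ true →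
             w ≢ u → w ≢ v → E₄ F R u w ≡ E₄ F R v w
  E₄-twins {R} complete uv w≢u w≢v = E₄-cong R (sameS-cong uv) λ uw →
    trans (complete uw (≢-sym w≢u)) (sym (complete (sameS-trans (sameS-sym uv) uw) (≢-sym w≢v)))

lemma24 : (n : ℕ) (E F H : BRel n) → IsGraph E → Irrefl F → Irrefl H →
          (c : Fin n → ℕ) → ValidClustering F H c →
          (E' : BRel n) → IsTransform E F H E' →
          ∀ u v → pairIn F u v ≡ true →
          (E' u v ≡ true) × (∀ w → w ≢ u → w ≢ v → E' u w ≡ E' v w)
lemma24 n E F H _ F-irrefl _ c valid E' (_ , R , (E₂⟶R , _) , E'≗E₄R) u v uv =
  trans (E'≗E₄R u v) (trans (E₄-within R u∼v) (complete u∼v u≢v)) ,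
  λ w w≢u w≢v → trans (E'≗E₄R u w) (trans (E₄-twins complete u∼v w≢u w≢v) (sym (E'≗E₄R v w)))
  where
  open Supernodes F
  open Transformation F H
  complete : CompleteOnSupernodes R
  complete = Star-complete E₂⟶R (E₂-complete E valid)
  u∼v : sameS F u v ≡ true
  u∼v = pairIn⇒sameS uv
  u≢v : u ≢ v
  u≢v refl = contradiction (trans (sym uv) (cong₂ _∨_ (F-irrefl u) (F-irrefl u))) λ ()
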